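{- Let $G$ be a multigraph and $v$ a pendant vertex of $G$ of degree $k$, $k\in\mathbb{N}$ (that is, $v$ has exactly one neighbor $u$ and $e_G(u,v)=k$). Let $G'=G-v$. Then for each $m\ge k$, $P_{DP}(G,m)=(m-k)P_{DP}(G',m)$ and $P^*_{DP}(G,m)=(m-1)P^*_{DP}(G',m)$.
   Context: All graphs are finite, nonempty, loopless multigraphs. For $u,v\in V(G)$, $E_G(u,v)$ is the set of edges joining $u,v$ and $e_G(u,v)=|E_G(u,v)|$. A cover of $G$ is a triple $\mathcal{H}=(L,H,M)$: $L$ assigns to each vertex a nonempty finite set, $H$ is a multigraph on $\bigcup_x L(x)$, $M$ assigns to each edge $e$ (with endpoints $u,v$) a matching $M(e)$ of $H$ whose edges go between $L(u)$ and $L(v)$, such that the $L(x)$ are pairwise disjoint, each $H[L(x)]$ is complete, $M(e_1)\cap M(e_2)=\emptyset$ for distinct edges, and for distinct $u,v$ the edges of $H$ between $L(u)$ and $L(v)$ are exactly $\bigcup_{e\in E_G(u,v)}M(e)$. It is a full $m$-fold cover if $|L(x)|=m$ for all $x$ and there are exactly $e_G(u,v)m$ edges of $H$ between $L(u)$ and $L(v)$ for all distinct $u,v$. An $\mathcal{H}$-coloring is an independent set of $H$ of size $|V(G)|$; $P_{DP}(G,\mathcal{H})$ is their number; $P_{DP}(G,m)$ and $P^*_{DP}(G,m)$ are the minimum and maximum of $P_{DP}(G,\mathcal{H})$ over all full $m$-fold covers $\mathcal{H}$ of $G$. -}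

module Defs where

open import Data.Nat using (ℕ; zero; suc; _+_; _*_; _≤_; _<_; _≡ᵇ_)
open import Data.Bool using (Bool; true; false; _∧_; _∨_; not; if_then_else_)
open import Data.Fin using (Fin; zero; suc; punchOut)
open import Data.Fin.Properties using () renaming (_≟_ to _≟ᶠ_)
open import Data.Product using (_×_; _,_; proj₁; proj₂; ∃; ∃-syntax; Σ-syntax)
open import Data.List using (List; []; _∷_; length; map; concatMap; filter; lookup; mapMaybe)
open import Data.Nat.ListAction using (sum)
open import Data.List.Relation.Unary.All using (All)
open import Data.Maybe using (Maybe; just; nothing)
open import Data.Vec using (Vec; []; _∷_) renaming (lookup to vlookup)
open import Relation.Nullary using (¬_; yes; no)
open import Relation.Nullary.Decidable using (⌊_⌋)
open import Relation.Binary.PropositionalEquality using (_≡_; _≢_)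

-- Multigraphs on the vertex set Fin n.  Edges form a list of ordered
-- endpoint pairs (a , b); the position in the list is the edge's identity,
-- so parallel edges are distinct list entries.

record Multigraph (n : ℕ) : Set where
  constructor mkGraph
  field
    edges : List (Fin n × Fin n)

open Multigraph public

Loopless : ∀ {n} → Multigraph n → Set
Loopless G = All (λ ab → proj₁ ab ≢ proj₂ ab) (edges G)

Edge : ∀ {n} → Multigraph n → Set
Edge G = Fin (length (edges G))

ends : ∀ {n} (G : Multigraph n) → Edge G → Fin n × Fin n
ends G j = lookup (edges G) j

joins : ∀ {n} → Fin n → Fin n → Fin n × Fin n → Bool
joins u v (a , b) = (⌊ a ≟ᶠ u ⌋ ∧ ⌊ b ≟ᶠ v ⌋) ∨ (⌊ a ≟ᶠ v ⌋ ∧ ⌊ b ≟ᶠ u ⌋)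

count : ∀ {A : Set} → (A → Bool) → List A → ℕ
count p []       = 0
count p (x ∷ xs) = (if p x then 1 else 0) + count p xs

eG : ∀ {n} → Multigraph n → Fin n → Fin n → ℕ
eG G u v = count (joins u v) (edges G)

Neighbor : ∀ {n} → Multigraph n → Fin n → Fin n → Set
Neighbor G w v = 0 < eG G w v

IsPendant : ∀ {n} → Multigraph n → Fin n → ℕ → Set
IsPendant G v k =
  ∃[ u ] (Neighbor G u v × eG G u v ≡ k × (∀ w → Neighbor G w v → w ≡ u))

delV : ∀ {n} → Fin (suc n) → Fin (suc n) → Maybe (Fin n)
delV v a with v ≟ᶠ a
... | yes _  = nothing
... | no v≢a = just (punchOut v≢a)

delE : ∀ {n} → Fin (suc n) → Fin (suc n) × Fin (suc n) → Maybe (Fin n × Fin n)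
delE v (a , b) with delV v a | delV v b
... | just a' | just b' = just (a' , b')
... | _       | _       = nothing

_─_ : ∀ {n} → Multigraph (suc n) → Fin (suc n) → Multigraph n
G ─ v = mkGraph (mapMaybe (delE v) (edges G))

-- Since |L(x)| = m for every x we take
-- L(x) = {x} × Fin m.  For an edge e with (ordered) endpoints (a , b),
-- M(e) is given by a Bool matrix: M e i j = true iff (a,i)(b,j) ∈ M(e).
-- The edges of H between L(u) and L(v) are exactly the (tagged) edges
-- of the matchings M(e), e ∈ E_G(u,v); being tagged by e, the M(e) are
-- pairwise disjoint edge sets of the multigraph H.

allFin : (m : ℕ) → List (Fin m)
allFin zero    = []
allFin (suc m) = zero ∷ map suc (allFin m)

size : ∀ {m} → (Fin m → Fin m → Bool) → ℕ
size {m} R = sum (map (λ i → count (R i) (allFin m)) (allFin m))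

IsMatching : ∀ {m} → (Fin m → Fin m → Bool) → Set
IsMatching R =
  (∀ i j j' → R i j ≡ true → R i j' ≡ true → j ≡ j') ×
  (∀ i i' j → R i j ≡ true → R i' j ≡ true → i ≡ i')

-- number of H-edges between L(u) and L(v)
edgesBetween : ∀ {n m} (G : Multigraph n) → (Edge G → Fin m → Fin m → Bool) →
               Fin n → Fin n → ℕ
edgesBetween G M u v =
  sum (map (λ j → if joins u v (ends G j) then size (M j) else 0)
           (allFin (length (edges G))))

record FullCover {n} (G : Multigraph n) (m : ℕ) : Set where
  field
    M        : Edge G → Fin m → Fin m → Bool
    matching : ∀ j → IsMatching (M j)
    full     : ∀ u v → u ≢ v → edgesBetween G M u v ≡ eG G u v * m

open FullCover public

-- H-colourings.  As each H[L(x)] is complete, an independent set of size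
-- |V(G)| contains exactly one vertex (x , c x) of each L(x); we encode it
-- by the vector c.

allVecs : (n m : ℕ) → List (Vec (Fin m) n)
allVecs zero    m = [] ∷ []
allVecs (suc n) m = concatMap (λ i → map (i ∷_) (allVecs n m)) (allFin m)

isColoring : ∀ {n m} {G : Multigraph n} → FullCover G m → Vec (Fin m) n → Bool
isColoring {G = G} H c =
  count (λ j → M H j (vlookup c (proj₁ (ends G j))) (vlookup c (proj₂ (ends G j))))
        (allFin (length (edges G))) ≡ᵇ 0

PDPcover : ∀ {n m} {G : Multigraph n} → FullCover G m → ℕ
PDPcover {n} {m} H = count (isColoring H) (allVecs n m)

IsPDP : ∀ {n} → Multigraph n → ℕ → ℕ → Set
IsPDP G m p = (Σ[ H ∈ FullCover G m ] PDPcover H ≡ p) × (∀ (H : FullCover G m) → p ≤ PDPcover H)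

IsPDP* : ∀ {n} → Multigraph n → ℕ → ℕ → Set
IsPDP* G m p = (Σ[ H ∈ FullCover G m ] PDPcover H ≡ p) × (∀ (H : FullCover G m) → PDPcover H ≤ p)

module Submission where

-- A colouring of G is a colouring c of G − v together with a colour x of v (insertAt c v x).
-- In a full m-fold cover H the matchings on the k edges uv are perfect, so once u has colour y
-- each of them forbids exactly one colour of v.  Hence
--   P_DP(G, H) = Σ_c [c is a colouring of the restricted cover] · #(colours of v left free),
-- and the number of free colours lies between m − k and m − 1, giving
--   (m − k) P_DP(G − v, H|) ≤ P_DP(G, H) ≤ (m − 1) P_DP(G − v, H|).
-- Both bounds are attained by extending an arbitrary cover of G − v: with the k matchings
-- x ≡ y + i (mod m), i < k, the forbidden colours are pairwise distinct, and with k copies of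
-- x = y they all coincide.

open import Defs
open import Data.Nat
open import Data.Nat.Properties
open import Algebra.Properties.CommutativeSemigroup +-commutativeSemigroup using (x∙yz≈y∙xz)
open import Algebra.Properties.Semiring.Sum +-*-semiring
  using (sum-syntax; sum-cong-≗; sum-remove; ∑-comm; ∑-distrib-+; *-distribˡ-sum)
open import Data.Bool using (Bool; true; false; if_then_else_)
open import Data.Bool.Properties using (∨-zeroʳ; ∨-identityʳ; ∧-zeroʳ)
open import Data.Fin using (Fin; zero; suc; toℕ; fromℕ<; punchIn; punchOut)
open import Data.Fin.Properties as Fin using (toℕ-fromℕ<; toℕ<n; toℕ-injective) renaming (_≟_ to _≟ᶠ_)
open import Data.List using (List; []; _∷_; map; _++_; concatMap; length; lookup; mapMaybe)
open import Data.List.Membership.Propositional using (_∈_)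
open import Data.List.Membership.Propositional.Properties using (∈-lookup)
open import Data.List.Properties using (map-∘)
open import Data.List.Relation.Unary.All as All using (All; []; _∷_)
open import Data.List.Relation.Unary.All.Properties using (mapMaybe⁺; map⁺)
open import Data.List.Relation.Unary.Any using (here; there)
open import Data.Maybe using (Maybe; just; nothing; is-nothing; maybe′)
open import Data.Maybe.Relation.Unary.All as Maybe using (just; nothing)
open import Data.Nat.DivMod using (_%_; _/_; m%n<n; m%n≤n; m≡m%n+[m/n]*n; %-distribˡ-+; [m+kn]%n≡m%n; m<n⇒m%n≡m)
open import Data.Nat.ListAction using (sum)
open import Data.Nat.Tactic.RingSolver using (solve-∀)
open import Data.Product using (_×_; _,_; proj₁; proj₂)
open import Data.Sum as Sum using (_⊎_; inj₁; inj₂; [_,_]′)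
open import Data.Vec using (Vec; []; _∷_; insertAt) renaming (lookup to _‼_)
open import Data.Vec.Properties using (insertAt-lookup; insertAt-punchIn)
open import Function using (_∘_; id)
open import Function.Definitions using (Injective)
open import Relation.Binary.PropositionalEquality
open import Relation.Nullary using (Dec; yes; no; ¬_)
open import Relation.Nullary.Decidable using (⌊_⌋; dec-true; dec-false; isYes≗does)

𝟙 : Bool → ℕ
𝟙 b = if b then 1 else 0

𝟙≤1 : ∀ b → 𝟙 b ≤ 1
𝟙≤1 true  = ≤-refl
𝟙≤1 false = z≤n

∑-const : ∀ m c → ∑[ i < m ] c ≡ m * c
∑-const zero    c = refl
∑-const (suc m) c = cong (c +_) (∑-const m c)

∑-one : ∀ m → ∑[ i < m ] 1 ≡ m
∑-one m = trans (∑-const m 1) (*-identityʳ m)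

∑-mono-≤ : ∀ {m} {f g : Fin m → ℕ} → (∀ i → f i ≤ g i) → ∑[ i < m ] f i ≤ ∑[ i < m ] g i
∑-mono-≤ {zero}  f≤g = z≤n
∑-mono-≤ {suc m} f≤g = +-mono-≤ (f≤g zero) (∑-mono-≤ (f≤g ∘ suc))

+-tight : ∀ {a b c d} → a ≤ c → b ≤ d → a + b ≡ c + d → a ≡ c × b ≡ d
+-tight {a} {b} {c} {d} a≤c b≤d eq = a≡c , +-cancelˡ-≡ a b d (trans eq (cong (_+ d) (sym a≡c)))
  where
  a≡c : a ≡ c
  a≡c = ≤-antisym a≤c (+-cancelʳ-≤ d c a (subst (_≤ a + d) eq (+-monoʳ-≤ a b≤d)))

∑-tight : ∀ {m} {f g : Fin m → ℕ} → (∀ i → f i ≤ g i) →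
          ∑[ i < m ] f i ≡ ∑[ i < m ] g i → ∀ i → f i ≡ g i
∑-tight {suc m} f≤g eq zero    = proj₁ (+-tight (f≤g zero) (∑-mono-≤ (f≤g ∘ suc)) eq)
∑-tight {suc m} f≤g eq (suc i) =
  ∑-tight (f≤g ∘ suc) (proj₂ (+-tight (f≤g zero) (∑-mono-≤ (f≤g ∘ suc)) eq)) i

∸-∑-≤ : ∀ {m} (f : Fin m → ℕ) → m ∸ ∑[ i < m ] f i ≤ ∑[ i < m ] (1 ∸ f i)
∸-∑-≤ {m} f = m≤n+o⇒m∸n≤o m (∑[ i < m ] f i) (begin
  m                                          ≡⟨ sym (∑-one m) ⟩
  ∑[ i < m ] 1                               ≤⟨ ∑-mono-≤ (λ i → m≤n+m∸n 1 (f i)) ⟩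
  ∑[ i < m ] (f i + (1 ∸ f i))               ≡⟨ ∑-distrib-+ f (λ i → 1 ∸ f i) ⟩
  ∑[ i < m ] f i + ∑[ i < m ] (1 ∸ f i)      ∎)
  where open ≤-Reasoning

∑-∸ : ∀ {m} (f : Fin m → ℕ) → (∀ i → f i ≤ 1) → ∑[ i < m ] (1 ∸ f i) ≡ m ∸ ∑[ i < m ] f i
∑-∸ {m} f f≤1 = sym (begin
  m ∸ ∑[ i < m ] f i                                        ≡⟨ cong (_∸ ∑[ i < m ] f i) m≡ ⟩
  ∑[ i < m ] (1 ∸ f i) + ∑[ i < m ] f i ∸ ∑[ i < m ] f i    ≡⟨ m+n∸n≡m (∑[ i < m ] (1 ∸ f i)) (∑[ i < m ] f i) ⟩
  ∑[ i < m ] (1 ∸ f i)                                      ∎)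
  where
  open ≡-Reasoning
  m≡ : m ≡ ∑[ i < m ] (1 ∸ f i) + ∑[ i < m ] f i
  m≡ = begin
    m                                      ≡⟨ sym (∑-one m) ⟩
    ∑[ i < m ] 1                           ≡⟨ sum-cong-≗ (λ i → sym (m∸n+n≡m (f≤1 i))) ⟩
    ∑[ i < m ] ((1 ∸ f i) + f i)           ≡⟨ ∑-distrib-+ (λ i → 1 ∸ f i) f ⟩
    ∑[ i < m ] (1 ∸ f i) + ∑[ i < m ] f i  ∎

∑-zero : ∀ m → ∑[ i < m ] 0 ≡ 0
∑-zero m = trans (∑-const m 0) (*-zeroʳ m)

∑-𝟙-≤1 : ∀ {m} (p : Fin m → Bool) → (∀ i j → p i ≡ true → p j ≡ true → i ≡ j) →
         ∑[ i < m ] 𝟙 (p i) ≤ 1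
∑-𝟙-≤1 {zero}  p unique = z≤n
∑-𝟙-≤1 {suc m} p unique with p zero in p₀
... | false = ∑-𝟙-≤1 (p ∘ suc) (λ i j pi pj → Fin.suc-injective (unique _ _ pi pj))
... | true  = s≤s (≤-trans (∑-mono-≤ others) (≤-reflexive (∑-zero m)))
  where
  others : ∀ i → 𝟙 (p (suc i)) ≤ 0
  others i with p (suc i) in pᵢ
  ... | false = z≤n
  ... | true with () ← unique zero (suc i) p₀ pᵢ

∑-point : ∀ {m} (f : Fin m → ℕ) i → f i ≤ ∑[ j < m ] f j
∑-point {suc m} f i = ≤-trans (m≤m+n (f i) _) (≤-reflexive (sym (sum-remove {i = i} f)))

⌊⌋-yes : ∀ {A : Set} (d : Dec A) → A → ⌊ d ⌋ ≡ true
⌊⌋-yes d a = trans (isYes≗does d) (dec-true d a)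

⌊⌋-no : ∀ {A : Set} (d : Dec A) → ¬ A → ⌊ d ⌋ ≡ false
⌊⌋-no d ¬a = trans (isYes≗does d) (dec-false d ¬a)

≟-true : ∀ {m} {x a : Fin m} → ⌊ x ≟ᶠ a ⌋ ≡ true → x ≡ a
≟-true {x = x} {a} eq with x ≟ᶠ a
... | yes x≡a = x≡a

∑-𝟙-≟ : ∀ {m} (a : Fin m) → ∑[ x < m ] 𝟙 ⌊ x ≟ᶠ a ⌋ ≡ 1
∑-𝟙-≟ {m} a = ≤-antisym
  (∑-𝟙-≤1 (λ x → ⌊ x ≟ᶠ a ⌋) (λ i j i≡a j≡a → trans (≟-true i≡a) (sym (≟-true j≡a))))
  (subst (_≤ ∑[ x < m ] 𝟙 ⌊ x ≟ᶠ a ⌋) (cong 𝟙 (⌊⌋-yes (a ≟ᶠ a) refl)) (∑-point _ a))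

count-++ : ∀ {A : Set} (p : A → Bool) xs ys → count p (xs ++ ys) ≡ count p xs + count p ys
count-++ p []       ys = refl
count-++ p (x ∷ xs) ys = trans (cong (𝟙 (p x) +_) (count-++ p xs ys)) (sym (+-assoc (𝟙 (p x)) _ _))

count-pos : ∀ {A : Set} {p : A → Bool} {x xs} → x ∈ xs → p x ≡ true → 0 < count p xs
count-pos {p = p} {xs = y ∷ ys} (here refl) px rewrite px = s≤s z≤n
count-pos {p = p} {xs = y ∷ ys} (there x∈ys) px = ≤-trans (count-pos x∈ys px) (m≤n+m _ (𝟙 (p y)))

count-false : ∀ {A : Set} {p : A → Bool} {xs} → All (λ x → p x ≡ false) xs → count p xs ≡ 0
count-false []             = refl
count-false (px ∷ pxs) rewrite px = count-false pxs

count-map : ∀ {A B : Set} (p : B → Bool) (f : A → B) xs → count p (map f xs) ≡ count (p ∘ f) xs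
count-map p f []       = refl
count-map p f (x ∷ xs) = cong (𝟙 (p (f x)) +_) (count-map p f xs)

count-concatMap : ∀ {A B : Set} (p : B → Bool) (f : A → List B) xs →
                  count p (concatMap f xs) ≡ sum (map (count p ∘ f) xs)
count-concatMap p f []       = refl
count-concatMap p f (x ∷ xs) =
  trans (count-++ p (f x) (concatMap f xs)) (cong (count p (f x) +_) (count-concatMap p f xs))

sum-map-allFin : ∀ m (g : Fin m → ℕ) → sum (map g (allFin m)) ≡ ∑[ i < m ] g i
sum-map-allFin zero    g = refl
sum-map-allFin (suc m) g =
  cong (g zero +_) (trans (cong sum (sym (map-∘ (allFin m)))) (sum-map-allFin m (g ∘ suc)))

count-allFin : ∀ m (p : Fin m → Bool) → count p (allFin m) ≡ ∑[ i < m ] 𝟙 (p i)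
count-allFin zero    p = refl
count-allFin (suc m) p =
  cong (𝟙 (p zero) +_) (trans (count-map p suc (allFin m)) (count-allFin m (p ∘ suc)))

∑-if-lookup : ∀ {A : Set} (p : A → Bool) c xs →
              ∑[ j < length xs ] (if p (lookup xs j) then c else 0) ≡ count p xs * c
∑-if-lookup p c []       = refl
∑-if-lookup p c (x ∷ xs) with p x
... | true  = cong (c +_) (∑-if-lookup p c xs)
... | false = ∑-if-lookup p c xs

module _ {m : ℕ} where

  ∑ᵛ : ∀ n → (Vec (Fin m) n → ℕ) → ℕ
  ∑ᵛ zero    g = g []
  ∑ᵛ (suc n) g = ∑[ x < m ] ∑ᵛ n (λ c → g (x ∷ c))

  ∑ᵛ-cong : ∀ n {g h : Vec (Fin m) n → ℕ} → (∀ c → g c ≡ h c) → ∑ᵛ n g ≡ ∑ᵛ n h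
  ∑ᵛ-cong zero    g≗h = g≗h []
  ∑ᵛ-cong (suc n) g≗h = sum-cong-≗ (λ x → ∑ᵛ-cong n (λ c → g≗h (x ∷ c)))

  ∑ᵛ-mono-≤ : ∀ n {g h : Vec (Fin m) n → ℕ} → (∀ c → g c ≤ h c) → ∑ᵛ n g ≤ ∑ᵛ n h
  ∑ᵛ-mono-≤ zero    g≤h = g≤h []
  ∑ᵛ-mono-≤ (suc n) g≤h = ∑-mono-≤ (λ x → ∑ᵛ-mono-≤ n (λ c → g≤h (x ∷ c)))

  *-distribˡ-∑ᵛ : ∀ n a (g : Vec (Fin m) n → ℕ) → a * ∑ᵛ n g ≡ ∑ᵛ n (λ c → a * g c)
  *-distribˡ-∑ᵛ zero    a g = refl
  *-distribˡ-∑ᵛ (suc n) a g =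
    trans (*-distribˡ-sum a (λ x → ∑ᵛ n (λ c → g (x ∷ c)))) (sum-cong-≗ (λ x → *-distribˡ-∑ᵛ n a (λ c → g (x ∷ c))))

  ∑ᵛ-∑-comm : ∀ n {l} (g : Vec (Fin m) n → Fin l → ℕ) →
              ∑ᵛ n (λ c → ∑[ x < l ] g c x) ≡ ∑[ x < l ] ∑ᵛ n (λ c → g c x)
  ∑ᵛ-∑-comm zero    g = refl
  ∑ᵛ-∑-comm (suc n) g =
    trans (sum-cong-≗ (λ y → ∑ᵛ-∑-comm n (λ c → g (y ∷ c)))) (∑-comm (λ y x → ∑ᵛ n (λ c → g (y ∷ c) x)))

  ∑ᵛ-insertAt : ∀ n (v : Fin (suc n)) (g : Vec (Fin m) (suc n) → ℕ) →
                ∑ᵛ (suc n) g ≡ ∑ᵛ n (λ c → ∑[ x < m ] g (insertAt c v x))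
  ∑ᵛ-insertAt n       zero    g = sym (∑ᵛ-∑-comm n (λ c x → g (x ∷ c)))
  ∑ᵛ-insertAt (suc n) (suc v) g = sum-cong-≗ (λ y → ∑ᵛ-insertAt n v (λ c → g (y ∷ c)))

  count-allVecs : ∀ n (p : Vec (Fin m) n → Bool) → count p (allVecs n m) ≡ ∑ᵛ n (𝟙 ∘ p)
  count-allVecs zero    p = +-identityʳ (𝟙 (p []))
  count-allVecs (suc n) p = begin
    count p (concatMap (λ x → map (x ∷_) (allVecs n m)) (allFin m))  ≡⟨ count-concatMap p _ (allFin m) ⟩
    sum (map (λ x → count p (map (x ∷_) (allVecs n m))) (allFin m))  ≡⟨ sum-map-allFin m _ ⟩
    ∑[ x < m ] count p (map (x ∷_) (allVecs n m))                    ≡⟨ sum-cong-≗ per-head ⟩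
    ∑ᵛ (suc n) (𝟙 ∘ p)                                               ∎
    where
    open ≡-Reasoning
    per-head : ∀ x → count p (map (x ∷_) (allVecs n m)) ≡ ∑ᵛ n (λ c → 𝟙 (p (x ∷ c)))
    per-head x = trans (count-map p (x ∷_) (allVecs n m)) (count-allVecs n (p ∘ (x ∷_)))

  ∑ᵛ-weighted-≥ : ∀ n {a} (g w : Vec (Fin m) n → ℕ) → (∀ c → a ≤ w c) → a * ∑ᵛ n g ≤ ∑ᵛ n (λ c → g c * w c)
  ∑ᵛ-weighted-≥ n {a} g w a≤w = begin
    a * ∑ᵛ n g              ≡⟨ *-distribˡ-∑ᵛ n a g ⟩
    ∑ᵛ n (λ c → a * g c)    ≤⟨ ∑ᵛ-mono-≤ n (λ c → ≤-trans (≤-reflexive (*-comm a (g c))) (*-monoʳ-≤ (g c) (a≤w c))) ⟩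
    ∑ᵛ n (λ c → g c * w c)  ∎
    where open ≤-Reasoning

  ∑ᵛ-weighted-≤ : ∀ n {a} (g w : Vec (Fin m) n → ℕ) → (∀ c → w c ≤ a) → ∑ᵛ n (λ c → g c * w c) ≤ a * ∑ᵛ n g
  ∑ᵛ-weighted-≤ n {a} g w w≤a = begin
    ∑ᵛ n (λ c → g c * w c)  ≤⟨ ∑ᵛ-mono-≤ n (λ c → ≤-trans (*-monoʳ-≤ (g c) (w≤a c)) (≤-reflexive (*-comm (g c) a))) ⟩
    ∑ᵛ n (λ c → a * g c)    ≡⟨ sym (*-distribˡ-∑ᵛ n a g) ⟩
    a * ∑ᵛ n g              ∎
    where open ≤-Reasoning

  ∑ᵛ-weighted-≡ : ∀ n {a} (g w : Vec (Fin m) n → ℕ) → (∀ c → w c ≡ a) → ∑ᵛ n (λ c → g c * w c) ≡ a * ∑ᵛ n g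
  ∑ᵛ-weighted-≡ n {a} g w w≡a = trans (∑ᵛ-cong n (λ c → trans (cong (g c *_) (w≡a c)) (*-comm (g c) a)))
                                      (sym (*-distribˡ-∑ᵛ n a g))

-- Matchings

Mat : ℕ → Set
Mat m = Fin m → Fin m → Bool

module _ {m : ℕ} where

  IsPerfectMatching : Mat m → Set
  IsPerfectMatching R = IsMatching R × size R ≡ m

  transpose : Mat m → Mat m
  transpose R x y = R y x

  columnSum : Mat m → Fin m → ℕ
  columnSum R y = ∑[ x < m ] 𝟙 (R x y)

  size-∑ : (R : Mat m) → size R ≡ ∑[ x < m ] ∑[ y < m ] 𝟙 (R x y)
  size-∑ R = trans (sum-map-allFin m _) (sum-cong-≗ (λ x → count-allFin m (R x)))

  size-columnSum : (R : Mat m) → size R ≡ ∑[ y < m ] columnSum R y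
  size-columnSum R = trans (size-∑ R) (∑-comm (λ x y → 𝟙 (R x y)))

  columnSum-≤1 : ∀ {R} → IsMatching R → ∀ y → columnSum R y ≤ 1
  columnSum-≤1 {R} (_ , column-unique) y = ∑-𝟙-≤1 (λ x → R x y) (λ x x' → column-unique x x' y)

  columnSum-perfect : ∀ {R} → IsPerfectMatching R → ∀ y → columnSum R y ≡ 1
  columnSum-perfect {R} (matching , size≡m) = ∑-tight (columnSum-≤1 matching) (begin
    ∑[ y < m ] columnSum R y  ≡⟨ sym (size-columnSum R) ⟩
    size R                    ≡⟨ size≡m ⟩
    m                         ≡⟨ sym (∑-one m) ⟩
    ∑[ y < m ] 1              ∎)
    where open ≡-Reasoning

  size-≤ : ∀ {R} → IsMatching R → size R ≤ m
  size-≤ {R} matching = begin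
    size R                    ≡⟨ size-columnSum R ⟩
    ∑[ y < m ] columnSum R y  ≤⟨ ∑-mono-≤ (columnSum-≤1 matching) ⟩
    ∑[ y < m ] 1              ≡⟨ ∑-one m ⟩
    m                         ∎
    where open ≤-Reasoning

  transpose-perfect : ∀ {R} → IsPerfectMatching R → IsPerfectMatching (transpose R)
  transpose-perfect {R} ((row-unique , column-unique) , size≡m) =
    ((λ x y y' → column-unique y y' x) , (λ x x' y → row-unique y x x')) ,
    trans (size-∑ (transpose R)) (trans (sym (size-columnSum R)) size≡m)

  graph : (Fin m → Fin m) → Mat m
  graph π x y = ⌊ x ≟ᶠ π y ⌋

  columnSum-graph : ∀ π y → columnSum (graph π) y ≡ 1
  columnSum-graph π y = ∑-𝟙-≟ (π y)

  graph-perfect : ∀ {π} → Injective _≡_ _≡_ π → IsPerfectMatching (graph π)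
  graph-perfect {π} π-injective =
    ((λ x y y' x≡πy x≡πy' → π-injective (trans (sym (≟-true x≡πy)) (≟-true x≡πy'))) ,
     (λ x x' y x≡πy x'≡πy → trans (≟-true x≡πy) (sym (≟-true x'≡πy)))) ,
    trans (size-columnSum (graph π)) (trans (sum-cong-≗ (columnSum-graph π)) (∑-one m))

-- Cyclic shifts

module _ {m : ℕ} .{{_ : NonZero m}} where

  %-complement : ∀ c {a} → a < m → (m ∸ c % m + (c + a)) % m ≡ a
  %-complement c {a} a<m = begin
    (m ∸ r + (c + a)) % m            ≡⟨ cong (λ z → (m ∸ r + (z + a)) % m) (m≡m%n+[m/n]*n c m) ⟩
    (m ∸ r + (r + q * m + a)) % m    ≡⟨ cong (_% m) (regroup (m ∸ r) r (q * m) a) ⟩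
    (a + (m ∸ r + r + q * m)) % m    ≡⟨ cong (λ z → (a + (z + q * m)) % m) (m∸n+n≡m (m%n≤n c m)) ⟩
    (a + suc q * m) % m              ≡⟨ [m+kn]%n≡m%n a (suc q) m ⟩
    a % m                            ≡⟨ m<n⇒m%n≡m a<m ⟩
    a                                ∎
    where
    open ≡-Reasoning
    r = c % m
    q = c / m
    regroup : ∀ x r y a → x + (r + y + a) ≡ a + (x + r + y)
    regroup = solve-∀

  +-%-cancelˡ : ∀ c {a b} → a < m → b < m → (c + a) % m ≡ (c + b) % m → a ≡ b
  +-%-cancelˡ c {a} {b} a<m b<m eq = begin
    a                                      ≡⟨ sym (%-complement c a<m) ⟩
    (t + (c + a)) % m                      ≡⟨ %-distribˡ-+ t (c + a) m ⟩
    (t % m + (c + a) % m) % m              ≡⟨ cong (λ z → (t % m + z) % m) eq ⟩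
    (t % m + (c + b) % m) % m              ≡⟨ sym (%-distribˡ-+ t (c + b) m) ⟩
    (t + (c + b)) % m                      ≡⟨ %-complement c b<m ⟩
    b                                      ∎
    where
    open ≡-Reasoning
    t = m ∸ c % m

  rotate : ℕ → Fin m → Fin m
  rotate s y = fromℕ< (m%n<n (s + toℕ y) m)

  toℕ-rotate : ∀ s y → toℕ (rotate s y) ≡ (s + toℕ y) % m
  toℕ-rotate s y = toℕ-fromℕ< (m%n<n (s + toℕ y) m)

  rotate-injective : ∀ s → Injective _≡_ _≡_ (rotate s)
  rotate-injective s {y} {y'} eq = toℕ-injective (+-%-cancelˡ s (toℕ<n y) (toℕ<n y') (begin
    (s + toℕ y) % m    ≡⟨ sym (toℕ-rotate s y) ⟩
    toℕ (rotate s y)   ≡⟨ cong toℕ eq ⟩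
    toℕ (rotate s y')  ≡⟨ toℕ-rotate s y' ⟩
    (s + toℕ y') % m   ∎))
    where open ≡-Reasoning

  rotate-distinct : ∀ {s t} y → s < m → t < m → rotate s y ≡ rotate t y → s ≡ t
  rotate-distinct {s} {t} y s<m t<m eq = +-%-cancelˡ (toℕ y) s<m t<m (begin
    (toℕ y + s) % m    ≡⟨ cong (_% m) (+-comm (toℕ y) s) ⟩
    (s + toℕ y) % m    ≡⟨ sym (toℕ-rotate s y) ⟩
    toℕ (rotate s y)   ≡⟨ cong toℕ eq ⟩
    toℕ (rotate t y)   ≡⟨ toℕ-rotate t y ⟩
    (t + toℕ y) % m    ≡⟨ cong (_% m) (+-comm t (toℕ y)) ⟩
    (toℕ y + t) % m    ∎)
    where open ≡-Reasoning

-- Free colours of a pendant vertex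

𝟙-≡ᵇ0-≥ : ∀ s → 1 ∸ s ≤ 𝟙 (s ≡ᵇ 0)
𝟙-≡ᵇ0-≥ zero    = ≤-refl
𝟙-≡ᵇ0-≥ (suc s) = ≤-reflexive (0∸n≡0 s)

𝟙-≡ᵇ0 : ∀ {s} → s ≤ 1 → 𝟙 (s ≡ᵇ 0) ≡ 1 ∸ s
𝟙-≡ᵇ0 z≤n       = refl
𝟙-≡ᵇ0 (s≤s z≤n) = refl

𝟙-≡ᵇ0-+ : ∀ a b → 𝟙 ((a + b) ≡ᵇ 0) ≡ 𝟙 (a ≡ᵇ 0) * 𝟙 (b ≡ᵇ 0)
𝟙-≡ᵇ0-+ zero    b = sym (+-identityʳ _)
𝟙-≡ᵇ0-+ (suc a) b = refl

𝟙-≡ᵇ0-antitone : ∀ {s t} → s ≤ t → 𝟙 (t ≡ᵇ 0) ≤ 𝟙 (s ≡ᵇ 0)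
𝟙-≡ᵇ0-antitone {zero}  {t}     _   = 𝟙≤1 (t ≡ᵇ 0)
𝟙-≡ᵇ0-antitone {suc s} {suc t} _   = z≤n

module _ {m k : ℕ} where

  clashes : (Fin k → Mat m) → Fin m → Fin m → ℕ
  clashes ρ x y = ∑[ i < k ] 𝟙 (ρ i x y)

  -- ρ i is the matching of the i-th edge uv, rows indexed by the colours of v and columns by
  -- those of u; freeColours ρ y counts the colours of v compatible with colour y of u.
  freeColours : (Fin k → Mat m) → Fin m → ℕ
  freeColours ρ y = ∑[ x < m ] 𝟙 (clashes ρ x y ≡ᵇ 0)

  ∑-clashes : ∀ ρ y → (∀ i → columnSum (ρ i) y ≡ 1) → ∑[ x < m ] clashes ρ x y ≡ k
  ∑-clashes ρ y columns = begin
    ∑[ x < m ] ∑[ i < k ] 𝟙 (ρ i x y)  ≡⟨ ∑-comm (λ x i → 𝟙 (ρ i x y)) ⟩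
    ∑[ i < k ] columnSum (ρ i) y       ≡⟨ sum-cong-≗ columns ⟩
    ∑[ i < k ] 1                       ≡⟨ ∑-one k ⟩
    k                                  ∎
    where open ≡-Reasoning

  freeColours-≥ : ∀ ρ y → (∀ i → columnSum (ρ i) y ≡ 1) → m ∸ k ≤ freeColours ρ y
  freeColours-≥ ρ y columns = begin
    m ∸ k                                      ≡⟨ cong (m ∸_) (sym (∑-clashes ρ y columns)) ⟩
    m ∸ ∑[ x < m ] clashes ρ x y               ≤⟨ ∸-∑-≤ (λ x → clashes ρ x y) ⟩
    ∑[ x < m ] (1 ∸ clashes ρ x y)             ≤⟨ ∑-mono-≤ (λ x → 𝟙-≡ᵇ0-≥ (clashes ρ x y)) ⟩
    freeColours ρ y                            ∎
    where open ≤-Reasoning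

  freeColours-exact : ∀ ρ y → (∀ i → columnSum (ρ i) y ≡ 1) → (∀ x → clashes ρ x y ≤ 1) →
                      freeColours ρ y ≡ m ∸ k
  freeColours-exact ρ y columns clashes≤1 = begin
    freeColours ρ y                   ≡⟨ sum-cong-≗ (λ x → 𝟙-≡ᵇ0 (clashes≤1 x)) ⟩
    ∑[ x < m ] (1 ∸ clashes ρ x y)    ≡⟨ ∑-∸ (λ x → clashes ρ x y) clashes≤1 ⟩
    m ∸ ∑[ x < m ] clashes ρ x y      ≡⟨ cong (m ∸_) (∑-clashes ρ y columns) ⟩
    m ∸ k                             ∎
    where open ≡-Reasoning

module _ {m : ℕ} where

  freeColours-single : ∀ {R : Mat m} {y} → columnSum R y ≡ 1 → freeColours (λ (_ : Fin 1) → R) y ≡ m ∸ 1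
  freeColours-single {R} {y} column =
    freeColours-exact (λ (_ : Fin 1) → R) y (λ _ → column) (λ x → +-monoˡ-≤ 0 (𝟙≤1 (R x y)))

  freeColours-≤ : ∀ {k} (ρ : Fin k → Mat m) y → 0 < k → (∀ i → columnSum (ρ i) y ≡ 1) →
                  freeColours ρ y ≤ m ∸ 1
  freeColours-≤ {suc k} ρ y _ columns = begin
    freeColours ρ y                         ≤⟨ ∑-mono-≤ (λ x → 𝟙-≡ᵇ0-antitone (+-monoʳ-≤ (𝟙 (ρ zero x y)) z≤n)) ⟩
    freeColours (λ (_ : Fin 1) → ρ zero) y  ≡⟨ freeColours-single {R = ρ zero} (columns zero) ⟩
    m ∸ 1                                   ∎
    where open ≤-Reasoning

  freeColours-replicate : ∀ {k} → 0 < k → ∀ (R : Mat m) y →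
                          freeColours (λ (_ : Fin k) → R) y ≡ freeColours (λ (_ : Fin 1) → R) y
  freeColours-replicate {suc k} _ R y = sum-cong-≗ (λ x → cong 𝟙 (first-clash-decides x))
    where
    first-clash-decides : ∀ x → ((𝟙 (R x y) + ∑[ i < k ] 𝟙 (R x y)) ≡ᵇ 0) ≡ ((𝟙 (R x y) + 0) ≡ᵇ 0)
    first-clash-decides x with R x y
    ... | true  = refl
    ... | false = cong (_≡ᵇ 0) (∑-zero k)

  freeColours-cong : ∀ {k} {ρ σ : Fin k → Mat m} {y} → (∀ i x → ρ i x y ≡ σ i x y) →
                     freeColours ρ y ≡ freeColours σ y
  freeColours-cong ρ≗σ =
    sum-cong-≗ (λ x → cong (λ s → 𝟙 (s ≡ᵇ 0)) (sum-cong-≗ (λ i → cong 𝟙 (ρ≗σ i x))))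

  freeColours-identities : ∀ {k} → 0 < k → ∀ y → freeColours (λ (_ : Fin k) → graph id) y ≡ m ∸ 1
  freeColours-identities 0<k y =
    trans (freeColours-replicate 0<k (graph id) y) (freeColours-single {R = graph id} (columnSum-graph id y))

  freeColours-rotations : .{{_ : NonZero m}} → ∀ {k} → k ≤ m → ∀ y →
                          freeColours (λ (i : Fin k) → graph (rotate (toℕ i))) y ≡ m ∸ k
  freeColours-rotations {k} k≤m y =
    freeColours-exact (λ (i : Fin k) → graph (rotate (toℕ i))) y (λ i → columnSum-graph (rotate (toℕ i)) y)
      (λ x → ∑-𝟙-≤1 (λ i → ⌊ x ≟ᶠ rotate (toℕ i) y ⌋) (λ i j x≡ᵢ x≡ⱼ → toℕ-injective
        (rotate-distinct y (<-≤-trans (toℕ<n i) k≤m) (<-≤-trans (toℕ<n j) k≤m)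
          (trans (sym (≟-true x≡ᵢ)) (≟-true x≡ⱼ)))))

joins-self : ∀ {n} (a b : Fin n) → joins a b (a , b) ≡ true
joins-self a b rewrite ⌊⌋-yes (a ≟ᶠ a) refl | ⌊⌋-yes (b ≟ᶠ b) refl = refl

joins-flip : ∀ {n} (a b : Fin n) → joins b a (a , b) ≡ true
joins-flip a b rewrite ⌊⌋-yes (a ≟ᶠ a) refl | ⌊⌋-yes (b ≟ᶠ b) refl = ∨-zeroʳ _

joins-loop : ∀ {n} {a b : Fin n} w → a ≢ b → joins w w (a , b) ≡ false
joins-loop {a = a} {b} w a≢b with a ≟ᶠ w
... | yes refl rewrite ⌊⌋-no (b ≟ᶠ a) (a≢b ∘ sym) = refl
... | no _     = refl

joins-avoiding : ∀ {n} {a b : Fin n} u v → a ≢ v → b ≢ v → joins u v (a , b) ≡ false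
joins-avoiding {a = a} {b} u v a≢v b≢v
  rewrite ⌊⌋-no (a ≟ᶠ v) a≢v | ⌊⌋-no (b ≟ᶠ v) b≢v = trans (∨-identityʳ _) (∧-zeroʳ _)

ends-distinct : ∀ {n} {G : Multigraph n} → Loopless G → ∀ j → proj₁ (ends G j) ≢ proj₂ (ends G j)
ends-distinct loopless j = All.lookup loopless (∈-lookup j)

¬Neighbor-self : ∀ {n} {G : Multigraph n} → Loopless G → ∀ w → ¬ Neighbor G w w
¬Neighbor-self loopless w w~w with () ← subst (0 <_) (count-false (All.map (joins-loop w) loopless)) w~w

if-≤ : ∀ c {x y} → x ≤ y → (if c then x else 0) ≤ (if c then y else 0)
if-≤ true  x≤y = x≤y
if-≤ false _   = z≤n

if-true-cancel : ∀ {c} {x y : ℕ} → c ≡ true → (if c then x else 0) ≡ (if c then y else 0) → x ≡ y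
if-true-cancel refl eq = eq

module _ {n m : ℕ} (G : Multigraph n) where

  edgesBetween-∑ : ∀ (M : Edge G → Mat m) a b →
                   edgesBetween G M a b ≡ ∑[ j < length (edges G) ] (if joins a b (ends G j) then size (M j) else 0)
  edgesBetween-∑ M a b = sum-map-allFin (length (edges G)) _

  perfectCover : (M : Edge G → Mat m) → (∀ j → IsPerfectMatching (M j)) → FullCover G m
  perfectCover M perfect = record
    { M        = M
    ; matching = proj₁ ∘ perfect
    ; full     = λ a b _ → begin
        edgesBetween G M a b                                               ≡⟨ edgesBetween-∑ M a b ⟩
        ∑[ j < length (edges G) ] (if joins a b (ends G j) then size (M j) else 0)
          ≡⟨ sum-cong-≗ (λ j → cong (λ s → if joins a b (ends G j) then s else 0) (proj₂ (perfect j))) ⟩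
        ∑[ j < length (edges G) ] (if joins a b (ends G j) then m else 0)  ≡⟨ ∑-if-lookup (joins a b) m (edges G) ⟩
        eG G a b * m                                                       ∎
    }
    where open ≡-Reasoning

  cover-perfect : Loopless G → (H : FullCover G m) → ∀ j → IsPerfectMatching (M H j)
  cover-perfect loopless H j = matching H j , if-true-cancel (joins-self a b) (∑-tight {g = bound}
    (λ i → if-≤ (joins a b (ends G i)) (size-≤ (matching H i)))
    (begin
      ∑[ i < length (edges G) ] (if joins a b (ends G i) then size (M H i) else 0)
        ≡⟨ sym (edgesBetween-∑ (M H) a b) ⟩
      edgesBetween G (M H) a b           ≡⟨ full H a b (ends-distinct loopless j) ⟩
      eG G a b * m                       ≡⟨ sym (∑-if-lookup (joins a b) m (edges G)) ⟩
      ∑[ i < length (edges G) ] bound i  ∎) j)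
    where
    open ≡-Reasoning
    a = proj₁ (ends G j)
    b = proj₂ (ends G j)
    bound : Edge G → ℕ
    bound i = if joins a b (ends G i) then m else 0

  conflictAt : (Edge G → Mat m) → Vec (Fin m) n → Edge G → Bool
  conflictAt M c j = M j (c ‼ proj₁ (ends G j)) (c ‼ proj₂ (ends G j))

  conflicts : (Edge G → Mat m) → Vec (Fin m) n → ℕ
  conflicts M c = ∑[ j < length (edges G) ] 𝟙 (conflictAt M c j)

  conflicts-cong : ∀ {M M′ : Edge G → Mat m} → (∀ j → M j ≡ M′ j) → ∀ c → conflicts M c ≡ conflicts M′ c
  conflicts-cong M≡M′ c =
    sum-cong-≗ (λ j → cong (λ R → 𝟙 (R (c ‼ proj₁ (ends G j)) (c ‼ proj₂ (ends G j)))) (M≡M′ j))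

  #colourings : (Edge G → Mat m) → ℕ
  #colourings M = ∑ᵛ n (λ c → 𝟙 (conflicts M c ≡ᵇ 0))

  PDPcover-#colourings : (H : FullCover G m) → PDPcover H ≡ #colourings (M H)
  PDPcover-#colourings H = trans (count-allVecs n (isColoring H))
    (∑ᵛ-cong n (λ c → cong (λ s → 𝟙 (s ≡ᵇ 0)) (count-allFin (length (edges G)) (conflictAt (M H) c))))

module _ {A B : Set} (f : A → Maybe B) where

  #dropped : List A → ℕ
  #dropped []       = 0
  #dropped (x ∷ xs) = 𝟙 (is-nothing (f x)) + #dropped xs

  keptAt-∷ : ∀ {ys : List B} {l} w → (Fin (length ys) → Fin l) →
             Fin (length (maybe′ _∷_ id w ys)) → Fin (suc l)
  keptAt-∷ nothing  k i       = suc (k i)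
  keptAt-∷ (just _) k zero    = zero
  keptAt-∷ (just _) k (suc i) = suc (k i)

  keptAt : ∀ xs → Fin (length (mapMaybe f xs)) → Fin (length xs)
  keptAt []       ()
  keptAt (x ∷ xs) = keptAt-∷ (f x) (keptAt xs)

  droppedAt-∷ : ∀ {d l} (w : Maybe B) → (Fin d → Fin l) → Fin (𝟙 (is-nothing w) + d) → Fin (suc l)
  droppedAt-∷ nothing  k zero    = zero
  droppedAt-∷ nothing  k (suc i) = suc (k i)
  droppedAt-∷ (just _) k i       = suc (k i)

  droppedAt : ∀ xs → Fin (#dropped xs) → Fin (length xs)
  droppedAt []       ()
  droppedAt (x ∷ xs) = droppedAt-∷ (f x) (droppedAt xs)

  lookup-keptAt : ∀ xs i → f (lookup xs (keptAt xs i)) ≡ just (lookup (mapMaybe f xs) i)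
  lookup-keptAt (x ∷ xs) i with f x in fx | i
  ... | nothing | i     = lookup-keptAt xs i
  ... | just _  | zero  = fx
  ... | just _  | suc i = lookup-keptAt xs i

  lookup-droppedAt : ∀ xs i → f (lookup xs (droppedAt xs i)) ≡ nothing
  lookup-droppedAt (x ∷ xs) i with f x in fx | i
  ... | nothing | zero  = fx
  ... | nothing | suc i = lookup-droppedAt xs i
  ... | just _  | i     = lookup-droppedAt xs i

  position-∷ : ∀ {ys : List B} {d l} (w : Maybe B) → (Fin l → Fin (length ys) ⊎ Fin d) →
               Fin (suc l) → Fin (length (maybe′ _∷_ id w ys)) ⊎ Fin (𝟙 (is-nothing w) + d)
  position-∷ nothing  p zero    = inj₂ zero
  position-∷ nothing  p (suc j) = Sum.map id suc (p j)
  position-∷ (just _) p zero    = inj₁ zero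
  position-∷ (just _) p (suc j) = Sum.map suc id (p j)

  position : ∀ xs → Fin (length xs) → Fin (length (mapMaybe f xs)) ⊎ Fin (#dropped xs)
  position (x ∷ xs) = position-∷ (f x) (position xs)

  position-keptAt : ∀ xs i → position xs (keptAt xs i) ≡ inj₁ i
  position-keptAt (x ∷ xs) i with f x | i
  ... | nothing | i     = cong (Sum.map id suc) (position-keptAt xs i)
  ... | just _  | zero  = refl
  ... | just _  | suc i = cong (Sum.map suc id) (position-keptAt xs i)

  position-droppedAt : ∀ xs i → position xs (droppedAt xs i) ≡ inj₂ i
  position-droppedAt (x ∷ xs) i with f x | i
  ... | nothing | zero  = refl
  ... | nothing | suc i = cong (Sum.map id suc) (position-droppedAt xs i)
  ... | just _  | i     = cong (Sum.map suc id) (position-droppedAt xs i)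

  ∑-kept-dropped : ∀ xs (φ : Fin (length xs) → ℕ) →
                   ∑[ j < length xs ] φ j ≡
                   ∑[ i < length (mapMaybe f xs) ] φ (keptAt xs i) + ∑[ i < #dropped xs ] φ (droppedAt xs i)
  ∑-kept-dropped []       φ = refl
  ∑-kept-dropped (x ∷ xs) φ with f x
  ... | nothing = trans (cong (φ zero +_) (∑-kept-dropped xs (φ ∘ suc))) (x∙yz≈y∙xz (φ zero) ∑kept ∑dropped)
    where
    ∑kept    = ∑[ i < length (mapMaybe f xs) ] φ (suc (keptAt xs i))
    ∑dropped = ∑[ i < #dropped xs ] φ (suc (droppedAt xs i))
  ... | just _  = trans (cong (φ zero +_) (∑-kept-dropped xs (φ ∘ suc))) (sym (+-assoc (φ zero) ∑kept ∑dropped))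
    where
    ∑kept    = ∑[ i < length (mapMaybe f xs) ] φ (suc (keptAt xs i))
    ∑dropped = ∑[ i < #dropped xs ] φ (suc (droppedAt xs i))

  #dropped-count : ∀ {p : A → Bool} {xs} → All (λ x → is-nothing (f x) ≡ p x) xs → #dropped xs ≡ count p xs
  #dropped-count []           = refl
  #dropped-count (px ∷ pxs) = cong₂ _+_ (cong 𝟙 px) (#dropped-count pxs)

  extend : ∀ {X : Set} xs → (Fin (length (mapMaybe f xs)) → X) → (Fin (#dropped xs) → X) →
           Fin (length xs) → X
  extend xs g h = [ g , h ]′ ∘ position xs

  extend-keptAt : ∀ {X : Set} xs (g : Fin (length (mapMaybe f xs)) → X) (h : Fin (#dropped xs) → X) i →
                  extend xs g h (keptAt xs i) ≡ g i
  extend-keptAt xs g h i = cong [ g , h ]′ (position-keptAt xs i)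

  extend-droppedAt : ∀ {X : Set} xs (g : Fin (length (mapMaybe f xs)) → X) (h : Fin (#dropped xs) → X) i →
                     extend xs g h (droppedAt xs i) ≡ h i
  extend-droppedAt xs g h i = cong [ g , h ]′ (position-droppedAt xs i)

  extend-preserves : ∀ {X : Set} {P : X → Set} xs {g h} → (∀ i → P (g i)) → (∀ i → P (h i)) →
                     ∀ j → P (extend xs g h j)
  extend-preserves xs Pg Ph j with position xs j
  ... | inj₁ i = Pg i
  ... | inj₂ i = Ph i

-- Deleting a vertex

module _ {n : ℕ} (v : Fin (suc n)) where

  delV-just : ∀ {a a'} → delV v a ≡ just a' → punchIn v a' ≡ a
  delV-just {a} eq with v ≟ᶠ a
  delV-just {a} refl | no v≢a = Fin.punchIn-punchOut v≢a

  delV-nothing : ∀ {a} → delV v a ≡ nothing → a ≡ v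
  delV-nothing {a} eq with v ≟ᶠ a
  ... | yes v≡a = sym v≡a

  delE-just : ∀ {a b a' b'} → delE v (a , b) ≡ just (a' , b') → punchIn v a' ≡ a × punchIn v b' ≡ b
  delE-just {a} {b} eq with delV v a in va | delV v b in vb
  delE-just refl | just _ | just _ = delV-just va , delV-just vb

  delE-nothing : ∀ {a b} → delE v (a , b) ≡ nothing → a ≡ v ⊎ b ≡ v
  delE-nothing {a} {b} eq with delV v a in va | delV v b in vb
  ... | nothing | _       = inj₁ (delV-nothing va)
  ... | just _  | nothing = inj₂ (delV-nothing vb)

  Loopless-─ : ∀ {G : Multigraph (suc n)} → Loopless G → Loopless (G ─ v)
  Loopless-─ loopless = mapMaybe⁺ (map⁺ (All.map delE-distinct loopless))
    where
    delE-distinct : ∀ {e} → proj₁ e ≢ proj₂ e → Maybe.All (λ e' → proj₁ e' ≢ proj₂ e') (delE v e)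
    delE-distinct {a , b} a≢b with delE v (a , b) in eq
    ... | nothing        = nothing
    ... | just (a' , b') = just (λ a'≡b' → a≢b (begin
      a           ≡⟨ sym (proj₁ (delE-just eq)) ⟩
      punchIn v a' ≡⟨ cong (punchIn v) a'≡b' ⟩
      punchIn v b' ≡⟨ proj₂ (delE-just eq) ⟩
      b           ∎))
      where open ≡-Reasoning

module _ {n : ℕ} (G : Multigraph (suc n)) (v : Fin (suc n)) where

  kept : Edge (G ─ v) → Edge G
  kept = keptAt (delE v) (edges G)

  #vEdges : ℕ
  #vEdges = #dropped (delE v) (edges G)

  vEdge : Fin #vEdges → Edge G
  vEdge = droppedAt (delE v) (edges G)

module _ {n m : ℕ} (G : Multigraph (suc n)) (v : Fin (suc n)) where

  vConflicts : (Edge G → Mat m) → Vec (Fin m) n → Fin m → ℕ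
  vConflicts M c x = ∑[ i < #vEdges G v ] 𝟙 (conflictAt G M (insertAt c v x) (vEdge G v i))

  conflictAt-kept : ∀ (M : Edge G → Mat m) c x i →
                    conflictAt G M (insertAt c v x) (kept G v i) ≡ conflictAt (G ─ v) (M ∘ kept G v) c i
  conflictAt-kept M c x i =
    cong₂ (M (kept G v i)) (lookup-punchIn (proj₁ ends-kept)) (lookup-punchIn (proj₂ ends-kept))
    where
    ends-kept = delE-just v (lookup-keptAt (delE v) (edges G) i)
    lookup-punchIn : ∀ {a a'} → punchIn v a' ≡ a → insertAt c v x ‼ a ≡ c ‼ a'
    lookup-punchIn refl = insertAt-punchIn c v x _

  conflicts-insertAt : ∀ (M : Edge G → Mat m) c x →
                       conflicts G M (insertAt c v x) ≡ conflicts (G ─ v) (M ∘ kept G v) c + vConflicts M c x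
  conflicts-insertAt M c x =
    trans (∑-kept-dropped (delE v) (edges G) (𝟙 ∘ conflictAt G M (insertAt c v x)))
          (cong (_+ vConflicts M c x) (sum-cong-≗ (cong 𝟙 ∘ conflictAt-kept M c x)))

  #colourings-deleteVertex : ∀ (M : Edge G → Mat m) →
    #colourings G M ≡ ∑ᵛ n (λ c → 𝟙 (conflicts (G ─ v) (M ∘ kept G v) c ≡ᵇ 0) * ∑[ x < m ] 𝟙 (vConflicts M c x ≡ᵇ 0))
  #colourings-deleteVertex M = trans (∑ᵛ-insertAt n v (λ c → 𝟙 (conflicts G M c ≡ᵇ 0))) (∑ᵛ-cong n (λ c → begin
    ∑[ x < m ] 𝟙 (conflicts G M (insertAt c v x) ≡ᵇ 0)
      ≡⟨ sum-cong-≗ (λ x → cong (λ s → 𝟙 (s ≡ᵇ 0)) (conflicts-insertAt M c x)) ⟩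
    ∑[ x < m ] 𝟙 ((conflicts (G ─ v) (M ∘ kept G v) c + vConflicts M c x) ≡ᵇ 0)
      ≡⟨ sum-cong-≗ (λ x → 𝟙-≡ᵇ0-+ (conflicts (G ─ v) (M ∘ kept G v) c) (vConflicts M c x)) ⟩
    ∑[ x < m ] (𝟙 (conflicts (G ─ v) (M ∘ kept G v) c ≡ᵇ 0) * 𝟙 (vConflicts M c x ≡ᵇ 0))
      ≡⟨ sym (*-distribˡ-sum (𝟙 (conflicts (G ─ v) (M ∘ kept G v) c ≡ᵇ 0)) (λ x → 𝟙 (vConflicts M c x ≡ᵇ 0))) ⟩
    𝟙 (conflicts (G ─ v) (M ∘ kept G v) c ≡ᵇ 0) * ∑[ x < m ] 𝟙 (vConflicts M c x ≡ᵇ 0)  ∎))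
    where open ≡-Reasoning

-- Pendant vertices

IsPDP-transfer : ∀ {n n′ m a p} {G : Multigraph n} {G′ : Multigraph n′}
                 (restrict : FullCover G m → FullCover G′ m) (extend : FullCover G′ m → FullCover G m) →
                 (∀ H′ → PDPcover (extend H′) ≡ a * PDPcover H′) → (∀ H → a * PDPcover (restrict H) ≤ PDPcover H) →
                 IsPDP G′ m p → IsPDP G m (a * p)
IsPDP-transfer {a = a} restrict extend extend-scales restrict-≤ ((H′ , refl) , least) =
  (extend H′ , extend-scales H′) , λ H → ≤-trans (*-monoʳ-≤ a (least (restrict H))) (restrict-≤ H)

IsPDP*-transfer : ∀ {n n′ m a p} {G : Multigraph n} {G′ : Multigraph n′}
                  (restrict : FullCover G m → FullCover G′ m) (extend : FullCover G′ m → FullCover G m) →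
                  (∀ H′ → PDPcover (extend H′) ≡ a * PDPcover H′) → (∀ H → PDPcover H ≤ a * PDPcover (restrict H)) →
                  IsPDP* G′ m p → IsPDP* G m (a * p)
IsPDP*-transfer {a = a} restrict extend extend-scales restrict-≤ ((H′ , refl) , greatest) =
  (extend H′ , extend-scales H′) , λ H → ≤-trans (restrict-≤ H) (*-monoʳ-≤ a (greatest (restrict H)))

module Pendant {n m k : ℕ} (G : Multigraph (suc n)) (loopless : Loopless G) (v u : Fin (suc n))
               (u≢v : u ≢ v) (u-only : ∀ w → Neighbor G w v → w ≡ u) (eG≡k : eG G u v ≡ k) where

  u′ : Fin n
  u′ = punchOut (u≢v ∘ sym)

  insertAt-u : ∀ (c : Vec (Fin m) n) x → insertAt c v x ‼ u ≡ c ‼ u′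
  insertAt-u c x =
    trans (cong (insertAt c v x ‼_) (sym (Fin.punchIn-punchOut (u≢v ∘ sym)))) (insertAt-punchIn c v x u′)

  PendantEnds : Fin (suc n) × Fin (suc n) → Set
  PendantEnds e = e ≡ (v , u) ⊎ e ≡ (u , v)

  pendantEnds : ∀ {e} → e ∈ edges G → delE v e ≡ nothing → PendantEnds e
  pendantEnds {a , b} e∈G dropped with delE-nothing v dropped
  ... | inj₁ refl = inj₁ (cong (v ,_) (u-only b (count-pos e∈G (joins-flip v b))))
  ... | inj₂ refl = inj₂ (cong (_, v) (u-only a (count-pos e∈G (joins-self a v))))

  vEdge-ends : ∀ i → PendantEnds (ends G (vEdge G v i))
  vEdge-ends i = pendantEnds (∈-lookup (vEdge G v i)) (lookup-droppedAt (delE v) (edges G) i)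

  #vEdges≡k : #vEdges G v ≡ k
  #vEdges≡k = trans (#dropped-count (delE v) (All.tabulate dropped⇔joins)) eG≡k
    where
    dropped⇔joins : ∀ {e} → e ∈ edges G → is-nothing (delE v e) ≡ joins u v e
    dropped⇔joins {a , b} e∈G with delE v (a , b) in eq
    ... | nothing with pendantEnds e∈G eq
    ...   | inj₁ refl = sym (joins-flip v u)
    ...   | inj₂ refl = sym (joins-self u v)
    dropped⇔joins {a , b} e∈G | just (a' , b') = sym (joins-avoiding u v
      (λ a≡v → Fin.punchInᵢ≢i v a' (trans (proj₁ (delE-just v eq)) a≡v))
      (λ b≡v → Fin.punchInᵢ≢i v b' (trans (proj₂ (delE-just v eq)) b≡v)))

  -- Puts the colours of v on the rows, whichever way round the edge is stored.
  orient : Fin (suc n) × Fin (suc n) → Mat m → Mat m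
  orient e R = if ⌊ proj₁ e ≟ᶠ v ⌋ then R else transpose R

  orient-perfect : ∀ e {R} → IsPerfectMatching R → IsPerfectMatching (orient e R)
  orient-perfect e perfect with ⌊ proj₁ e ≟ᶠ v ⌋
  ... | true  = perfect
  ... | false = transpose-perfect perfect

  orient-involutive : ∀ e R x y → orient e (orient e R) x y ≡ R x y
  orient-involutive e R x y with ⌊ proj₁ e ≟ᶠ v ⌋
  ... | true  = refl
  ... | false = refl

  conflict-pendant : ∀ {e} → PendantEnds e → ∀ (R : Mat m) c x →
                     R (insertAt c v x ‼ proj₁ e) (insertAt c v x ‼ proj₂ e) ≡ orient e R x (c ‼ u′)
  conflict-pendant (inj₁ refl) R c x
    rewrite ⌊⌋-yes (v ≟ᶠ v) refl = cong₂ R (insertAt-lookup c v x) (insertAt-u c x)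
  conflict-pendant (inj₂ refl) R c x
    rewrite ⌊⌋-no (u ≟ᶠ v) u≢v = cong₂ R (insertAt-u c x) (insertAt-lookup c v x)

  vMatrices : (Edge G → Mat m) → Fin (#vEdges G v) → Mat m
  vMatrices M i = orient (ends G (vEdge G v i)) (M (vEdge G v i))

  #colourings-pendant : ∀ (M : Edge G → Mat m) →
    #colourings G M ≡ ∑ᵛ n (λ c → 𝟙 (conflicts (G ─ v) (M ∘ kept G v) c ≡ᵇ 0) * freeColours (vMatrices M) (c ‼ u′))
  #colourings-pendant M = trans (#colourings-deleteVertex G v M) (∑ᵛ-cong n (λ c →
    cong (𝟙 (conflicts (G ─ v) (M ∘ kept G v) c ≡ᵇ 0) *_) (sum-cong-≗ (λ x →
      cong (λ s → 𝟙 (s ≡ᵇ 0)) (sum-cong-≗ (λ i →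
        cong 𝟙 (conflict-pendant (vEdge-ends i) (M (vEdge G v i)) c x)))))))

  vMatrices-perfect : ∀ (H : FullCover G m) i → IsPerfectMatching (vMatrices (M H) i)
  vMatrices-perfect H i = orient-perfect (ends G (vEdge G v i)) (cover-perfect G loopless H (vEdge G v i))

  restrict : FullCover G m → FullCover (G ─ v) m
  restrict H = perfectCover (G ─ v) (M H ∘ kept G v) (cover-perfect G loopless H ∘ kept G v)

  PDPcover-pendant : ∀ (H : FullCover G m) →
    PDPcover H ≡ ∑ᵛ n (λ c → 𝟙 (conflicts (G ─ v) (M H ∘ kept G v) c ≡ᵇ 0) * freeColours (vMatrices (M H)) (c ‼ u′))
  PDPcover-pendant H = trans (PDPcover-#colourings G H) (#colourings-pendant (M H))

  PDPcover-restrict-≥ : ∀ H → (m ∸ k) * PDPcover (restrict H) ≤ PDPcover H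
  PDPcover-restrict-≥ H = begin
    (m ∸ k) * PDPcover (restrict H)  ≡⟨ cong ((m ∸ k) *_) (PDPcover-#colourings (G ─ v) (restrict H)) ⟩
    (m ∸ k) * ∑ᵛ n proper            ≤⟨ ∑ᵛ-weighted-≥ n proper free (λ c → subst (λ l → m ∸ l ≤ free c) #vEdges≡k
                                          (freeColours-≥ (vMatrices (M H)) (c ‼ u′) (columns c))) ⟩
    ∑ᵛ n (λ c → proper c * free c)   ≡⟨ sym (PDPcover-pendant H) ⟩
    PDPcover H                       ∎
    where
    open ≤-Reasoning
    proper = λ c → 𝟙 (conflicts (G ─ v) (M H ∘ kept G v) c ≡ᵇ 0)
    free = λ c → freeColours (vMatrices (M H)) (c ‼ u′)
    columns = λ c i → columnSum-perfect (vMatrices-perfect H i) (c ‼ u′)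

  PDPcover-restrict-≤ : 0 < k → ∀ H → PDPcover H ≤ (m ∸ 1) * PDPcover (restrict H)
  PDPcover-restrict-≤ 0<k H = begin
    PDPcover H                       ≡⟨ PDPcover-pendant H ⟩
    ∑ᵛ n (λ c → proper c * free c)   ≤⟨ ∑ᵛ-weighted-≤ n proper free (λ c →
                                          freeColours-≤ (vMatrices (M H)) (c ‼ u′)
                                            (subst (0 <_) (sym #vEdges≡k) 0<k) (columns c)) ⟩
    (m ∸ 1) * ∑ᵛ n proper            ≡⟨ cong ((m ∸ 1) *_) (sym (PDPcover-#colourings (G ─ v) (restrict H))) ⟩
    (m ∸ 1) * PDPcover (restrict H)  ∎
    where
    open ≤-Reasoning
    proper = λ c → 𝟙 (conflicts (G ─ v) (M H ∘ kept G v) c ≡ᵇ 0)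
    free = λ c → freeColours (vMatrices (M H)) (c ‼ u′)
    columns = λ c i → columnSum-perfect (vMatrices-perfect H i) (c ‼ u′)

  module _ (σ : Fin (#vEdges G v) → Mat m) (σ-perfect : ∀ i → IsPerfectMatching (σ i)) where

    extendedMatrices : FullCover (G ─ v) m → Edge G → Mat m
    extendedMatrices H′ = extend (delE v) (edges G) (M H′) (λ i → orient (ends G (vEdge G v i)) (σ i))

    extendCover : FullCover (G ─ v) m → FullCover G m
    extendCover H′ = perfectCover G (extendedMatrices H′)
      (extend-preserves (delE v) {P = IsPerfectMatching} (edges G) (cover-perfect (G ─ v) (Loopless-─ v loopless) H′)
                        (λ i → orient-perfect (ends G (vEdge G v i)) (σ-perfect i)))

    PDPcover-extendCover : ∀ {a} → (∀ y → freeColours σ y ≡ a) → ∀ H′ → PDPcover (extendCover H′) ≡ a * PDPcover H′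
    PDPcover-extendCover {a} free≡a H′ = begin
      PDPcover (extendCover H′)
        ≡⟨ PDPcover-pendant (extendCover H′) ⟩
      ∑ᵛ n (λ c → 𝟙 (conflicts (G ─ v) (extendedMatrices H′ ∘ kept G v) c ≡ᵇ 0) * free c)
        ≡⟨ ∑ᵛ-cong n (λ c → cong (λ s → 𝟙 (s ≡ᵇ 0) * free c) (conflicts-cong (G ─ v) restricts c)) ⟩
      ∑ᵛ n (λ c → 𝟙 (conflicts (G ─ v) (M H′) c ≡ᵇ 0) * free c)
        ≡⟨ ∑ᵛ-weighted-≡ n _ free (λ c → trans (freeColours-cong {ρ = ρ} {σ} (vMatrices≗σ (c ‼ u′)))
                                                (free≡a (c ‼ u′))) ⟩
      a * #colourings (G ─ v) (M H′)
        ≡⟨ cong (a *_) (sym (PDPcover-#colourings (G ─ v) H′)) ⟩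
      a * PDPcover H′  ∎
      where
      open ≡-Reasoning
      ρ = vMatrices (extendedMatrices H′)
      free = λ c → freeColours ρ (c ‼ u′)
      restricts : ∀ j → extendedMatrices H′ (kept G v j) ≡ M H′ j
      restricts = extend-keptAt (delE v) (edges G) (M H′) _
      vMatrices≗σ : ∀ y i x → ρ i x y ≡ σ i x y
      vMatrices≗σ y i x = trans (cong (λ R → orient e R x y) (extend-droppedAt (delE v) (edges G) (M H′) _ i))
                                (orient-involutive e (σ i) x y)
        where e = ends G (vEdge G v i)

  identities : Fin (#vEdges G v) → Mat m
  identities _ = graph id

  identities-perfect : ∀ i → IsPerfectMatching (identities i)
  identities-perfect _ = graph-perfect id

  PDPcover-extend-identities : 0 < k → ∀ H′ →
                               PDPcover (extendCover identities identities-perfect H′) ≡ (m ∸ 1) * PDPcover H′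
  PDPcover-extend-identities 0<k = PDPcover-extendCover identities identities-perfect
    (freeColours-identities (subst (0 <_) (sym #vEdges≡k) 0<k))

  module _ .{{_ : NonZero m}} where

    rotations : Fin (#vEdges G v) → Mat m
    rotations i = graph (rotate (toℕ i))

    rotations-perfect : ∀ i → IsPerfectMatching (rotations i)
    rotations-perfect i = graph-perfect (rotate-injective (toℕ i))

    PDPcover-extend-rotations : k ≤ m → ∀ H′ →
                                PDPcover (extendCover rotations rotations-perfect H′) ≡ (m ∸ k) * PDPcover H′
    PDPcover-extend-rotations k≤m = PDPcover-extendCover rotations rotations-perfect (λ y →
      trans (freeColours-rotations (subst (_≤ m) (sym #vEdges≡k) k≤m) y) (cong (m ∸_) #vEdges≡k))

proposition12 : ∀ {n} (G : Multigraph (suc n)) → Loopless G →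
                (v : Fin (suc n)) (k : ℕ) → IsPendant G v k →
                (m : ℕ) → k ≤ m →
                (∀ p → IsPDP (G ─ v) m p → IsPDP G m ((m ∸ k) * p)) ×
                (∀ p → IsPDP* (G ─ v) m p → IsPDP* G m ((m ∸ 1) * p))
proposition12 G loopless v k (u , u~v , eG≡k , u-only) m k≤m =
  (λ _ → IsPDP-transfer {a = m ∸ k} restrict (extendCover rotations rotations-perfect)
                        (PDPcover-extend-rotations k≤m) PDPcover-restrict-≥) ,
  (λ _ → IsPDP*-transfer {a = m ∸ 1} restrict (extendCover identities identities-perfect)
                         (PDPcover-extend-identities 0<k) (PDPcover-restrict-≤ 0<k))
  where
  0<k : 0 < k
  0<k = subst (0 <_) eG≡k u~v

  u≢v : u ≢ v
  u≢v refl = ¬Neighbor-self loopless u u~v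

  instance
    m≢0 : NonZero m
    m≢0 = >-nonZero (<-≤-trans 0<k k≤m)

  open Pendant {m = m} G loopless v u u≢v u-only eG≡k
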